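{- For every integer $n>1$, \[ CP_{(2,0)}(n,X,Y)=\frac{1-X_{n-1}X_{n}Y_{n-2}Y_{n-1}}{(1-X_{n}Y_{n-2})(1-X_{n}Y_{n-1})(1-X_{n}Y_{n})}\, CP_{(2,0)}(n-1,X,Y). \]
   Context: Let $x_1,x_2,\dots,y_1,y_2,\dots$ be formal variables, $X_i:=x_1\cdots x_i$, $Y_i:=y_1\cdots y_i$ for $i\ge1$, and $X_i=Y_i:=1$ for $i\le 0$. For $n\ge1$, $CP_{(2,0)}(n,X,Y):=\sum \prod_{i=1}^n x_i^{a_i}y_i^{b_i}$, summed over all tuples of nonnegative integers $(a_1,\dots,a_n,b_1,\dots,b_n)$ with $a_1\ge\dots\ge a_n$, $b_1\ge\dots\ge b_n$, $a_j\ge b_{j}$ and $b_j\ge a_{j+2}$ for all $j\ge1$, where $a_j=b_j=0$ for $j>n$ (cylindric partitions with profile $(2,0)$ with at most $n$ nonzero entries in each row). -}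

module Defs where

open import Data.Nat using (ℕ; zero; suc; _+_; _∸_; _≤ᵇ_; _<ᵇ_; _≡ᵇ_)
open import Data.Bool using (Bool; true; false; _∧_; if_then_else_)
open import Data.Integer using (ℤ; _-_; 0ℤ; 1ℤ)
open import Relation.Binary.PropositionalEquality using (_≡_)
open import Data.Fin using (Fin; toℕ)
open import Data.Vec using (Vec; []; _∷_; tabulate; zipWith; lookup; init; last)
open import Data.Product using (_×_; _,_)

-- Exponent vectors for the 2n variables x_1..x_n, y_1..y_n:
-- (a , b) with a = (a_1,...,a_n), b = (b_1,...,b_n), stored 0-indexed.
Exp : ℕ → Set
Exp n = Vec ℕ n × Vec ℕ n

-- A formal power series in x_1..x_n, y_1..y_n with integer coefficients,
-- given by its coefficient function.  Equality = equality of all coefficients.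
Series : ℕ → Set
Series n = Exp n → ℤ

_≈ₛ_ : ∀ {n} → Series n → Series n → Set
F ≈ₛ G = ∀ e → F e ≡ G e
infix 4 _≈ₛ_

leqV : ∀ {n} → Vec ℕ n → Vec ℕ n → Bool
leqV [] [] = true
leqV (x ∷ xs) (y ∷ ys) = (x ≤ᵇ y) ∧ leqV xs ys

leqE : ∀ {n} → Exp n → Exp n → Bool
leqE (a , b) (a' , b') = leqV a a' ∧ leqV b b'

subE : ∀ {n} → Exp n → Exp n → Exp n
subE (a , b) (a' , b') = zipWith _∸_ a a' , zipWith _∸_ b b'

addE : ∀ {n} → Exp n → Exp n → Exp n
addE (a , b) (a' , b') = zipWith _+_ a a' , zipWith _+_ b b'

-- exponent vector of the prefix product z_1 ⋯ z_i (all-zero vector if i ≤ 0)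
prefix : (n i : ℕ) → Vec ℕ n
prefix n i = tabulate (λ k → if toℕ k <ᵇ i then 1 else 0)

XY : (n i j : ℕ) → Exp n
XY n i j = prefix n i , prefix n j

-- multiplication of a series by the monomial with exponent m
shift : ∀ {n} → Exp n → Series n → Series n
shift m F e = if leqE m e then F (subE e m) else 0ℤ

oneMinus : ∀ {n} → Exp n → Series n → Series n
oneMinus m F e = F e - shift m F e

-- entry z_j (0-indexed) of a vector, with z_j = 0 for j ≥ n
get : ∀ {n} → Vec ℕ n → ℕ → ℕ
get [] _ = 0
get (x ∷ xs) zero = x
get (x ∷ xs) (suc j) = get xs j

-- (a , b) is a cylindric partition of profile (2,0) with at most n nonzero
-- entries per row.  0-indexed: a j = a_{j+1}.
allBelow : ℕ → (ℕ → Bool) → Bool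
allBelow zero p = true
allBelow (suc n) p = allBelow n p ∧ p n

isCP : ∀ {n} → Exp n → Bool
isCP {n} (a , b) = allBelow n ok
  where
  ok : ℕ → Bool
  ok j = (get a (suc j) ≤ᵇ get a j) ∧ (get b (suc j) ≤ᵇ get b j)
       ∧ (get b j ≤ᵇ get a j) ∧ (get a (suc (suc j)) ≤ᵇ get b j)

CP : (n : ℕ) → Series n
CP n e = if isCP e then 1ℤ else 0ℤ

extend : ∀ {k} → Series k → Series (suc k)
extend F (a , b) =
  if (last a ≡ᵇ 0) ∧ (last b ≡ᵇ 0) then F (init a , init b) else 0ℤ

CPprev : (n : ℕ) → Series n
CPprev zero = λ _ → 0ℤ
CPprev (suc k) = extend (CP k)

{-# OPTIONS --safe #-}
-- Multiplying a generating function by a monomial x^m translates its support by m.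
-- Cleared of denominators, the left side removes from CP_n first its translate by XₙYₙ
-- (the partitions with bₙ > 0), then the translate by XₙYₙ₋₁ of what is left; this leaves
-- the partitions with bₙ = 0 and aₙ = 0 or bₙ₋₁ = 0, whose translate by XₙYₙ₋₂ is subtracted
-- last. On the right, CP_{n-1} is the set of partitions with vanishing last column. The two
-- sides agree: the partitions with bₙ = bₙ₋₁ = 0 < aₙ occur in both terms on the left, and
-- the rest of the translate by XₙYₙ₋₂ is exactly the translate of CP_{n-1} by Xₙ₋₁XₙYₙ₋₂Yₙ₋₁.
-- Each translate is cut out by a condition on the last two or three columns, so it is proved
-- by induction on n, adding in front a column on which the monomial is constant; the cases
-- n = 2 and n = 3 are checked directly.
module Submission where

open import Defs
open import Algebra using (CommutativeMonoid)
open import Data.Bool using (Bool; true; false; T; not; _∧_; _∨_; if_then_else_)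
open import Data.Bool.Properties using (∧-commutativeMonoid; ∧-identityʳ; ∧-assoc)
open import Data.Empty using (⊥-elim)
open import Data.Integer using (ℤ; 0ℤ; 1ℤ; _-_)
open import Data.Nat using (ℕ; zero; suc; _+_; _∸_; _≤_; _<_; _≤ᵇ_; _<ᵇ_; _≡ᵇ_; z≤n; s≤s; s≤s⁻¹)
open import Data.Nat.Properties
  using (≤ᵇ⇒≤; ≤⇒≤ᵇ; <ᵇ⇒<; <⇒<ᵇ; ≡ᵇ⇒≡; ≤-trans; m≤n⇒m≤1+n; m+[n∸m]≡n)
open import Data.Product using (_×_; _,_; proj₁; proj₂)
open import Data.Unit using (tt)
open import Data.Vec using (Vec; []; _∷_; last; init; zipWith)
open import Function using (_∘_)
open import Relation.Binary.PropositionalEquality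
  using (_≡_; _≗_; refl; sym; trans; cong; cong₂; subst; module ≡-Reasoning)

open import Algebra.Properties.CommutativeSemigroup
  (CommutativeMonoid.commutativeSemigroup ∧-commutativeMonoid)
  using () renaming (x∙yz≈y∙xz to ∧-leftComm)

open ≡-Reasoning

T-injective : ∀ {p q} → (T p → T q) → (T q → T p) → p ≡ q
T-injective {false} {false} _ _ = refl
T-injective {false} {true}  _ g = ⊥-elim (g tt)
T-injective {true}  {false} f _ = ⊥-elim (f tt)
T-injective {true}  {true}  _ _ = refl

T-∧⁻ : ∀ p {q} → T (p ∧ q) → T p × T q
T-∧⁻ true h = tt , h

T-∧⁺ : ∀ {p q} → T p → T q → T (p ∧ q)
T-∧⁺ {true} _ h = h

suc-≤ᵇ-suc : ∀ m n → (suc m ≤ᵇ suc n) ≡ (m ≤ᵇ n)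
suc-≤ᵇ-suc zero    n = refl
suc-≤ᵇ-suc (suc m) n = refl

<ᵇ-suc : ∀ m n → (m <ᵇ suc n) ≡ (m ≤ᵇ n)
<ᵇ-suc zero    n = refl
<ᵇ-suc (suc m) n = refl

+-≤ᵇ-cancelˡ : ∀ c m n → (c + m ≤ᵇ c + n) ≡ (m ≤ᵇ n)
+-≤ᵇ-cancelˡ zero    m n = refl
+-≤ᵇ-cancelˡ (suc c) m n = trans (suc-≤ᵇ-suc (c + m) (c + n)) (+-≤ᵇ-cancelˡ c m n)

addE-subE : ∀ {n} (m e : Exp n) → T (leqE m e) → addE m (subE e m) ≡ e
addE-subE (ma , mb) (a , b) m≤e with T-∧⁻ (leqV ma a) m≤e
... | ma≤a , mb≤b = cong₂ _,_ (+-∸-cancel ma a ma≤a) (+-∸-cancel mb b mb≤b)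
  where
  +-∸-cancel : ∀ {n} (u v : Vec ℕ n) → T (leqV u v) → zipWith _+_ u (zipWith _∸_ v u) ≡ v
  +-∸-cancel []       []       _ = refl
  +-∸-cancel (x ∷ xs) (y ∷ ys) h with T-∧⁻ (x ≤ᵇ y) h
  ... | x≤y , xs≤ys = cong₂ _∷_ (m+[n∸m]≡n (≤ᵇ⇒≤ x y x≤y)) (+-∸-cancel xs ys xs≤ys)

columnOK : ℕ → ℕ → ℕ → ℕ → ℕ → Bool
columnOK a₀ b₀ a₁ a₂ b₁ = (a₁ ≤ᵇ a₀) ∧ (b₁ ≤ᵇ b₀) ∧ (b₀ ≤ᵇ a₀) ∧ (a₂ ≤ᵇ b₀)

-- isCP (a , b) unfolds to allBelow n (columnOKAt (get a) (get b)).
columnOKAt : (ℕ → ℕ) → (ℕ → ℕ) → ℕ → Bool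
columnOKAt α β j = columnOK (α j) (β j) (α (1 + j)) (α (2 + j)) (β (1 + j))

columnOK⁻ : ∀ a₀ b₀ a₁ a₂ b₁ → T (columnOK a₀ b₀ a₁ a₂ b₁) →
            a₁ ≤ a₀ × b₁ ≤ b₀ × b₀ ≤ a₀ × a₂ ≤ b₀
columnOK⁻ a₀ b₀ a₁ a₂ b₁ h with T-∧⁻ (a₁ ≤ᵇ a₀) h
... | p , h₁ with T-∧⁻ (b₁ ≤ᵇ b₀) h₁
... | q , h₂ with T-∧⁻ (b₀ ≤ᵇ a₀) h₂
... | r , s = ≤ᵇ⇒≤ a₁ a₀ p , ≤ᵇ⇒≤ b₁ b₀ q , ≤ᵇ⇒≤ b₀ a₀ r , ≤ᵇ⇒≤ a₂ b₀ s

columnOK⁺ : ∀ {a₀ b₀ a₁ a₂ b₁} → a₁ ≤ a₀ → b₁ ≤ b₀ → b₀ ≤ a₀ → a₂ ≤ b₀ →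
            T (columnOK a₀ b₀ a₁ a₂ b₁)
columnOK⁺ p q r s = T-∧⁺ (≤⇒≤ᵇ p) (T-∧⁺ (≤⇒≤ᵇ q) (T-∧⁺ (≤⇒≤ᵇ r) (≤⇒≤ᵇ s)))

columnOK-+ : ∀ c a₀ b₀ a₁ a₂ b₁ →
             columnOK (c + a₀) (c + b₀) (c + a₁) (c + a₂) (c + b₁) ≡ columnOK a₀ b₀ a₁ a₂ b₁
columnOK-+ c a₀ b₀ a₁ a₂ b₁
  rewrite +-≤ᵇ-cancelˡ c a₁ a₀ | +-≤ᵇ-cancelˡ c b₁ b₀
        | +-≤ᵇ-cancelˡ c b₀ a₀ | +-≤ᵇ-cancelˡ c a₂ b₀ = refl

columnOKAt-cong : ∀ {α α′ β β′} → α ≗ α′ → β ≗ β′ → columnOKAt α β ≗ columnOKAt α′ β′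
columnOKAt-cong α≗α′ β≗β′ j
  rewrite α≗α′ j | α≗α′ (1 + j) | α≗α′ (2 + j) | β≗β′ j | β≗β′ (1 + j) = refl

allBelow-suc : ∀ n p → allBelow (suc n) p ≡ p 0 ∧ allBelow n (p ∘ suc)
allBelow-suc zero    p = sym (∧-identityʳ (p 0))
allBelow-suc (suc n) p =
  trans (cong (_∧ p (suc n)) (allBelow-suc n p)) (∧-assoc (p 0) _ (p (suc n)))

allBelow-cong : ∀ n {p q : ℕ → Bool} → p ≗ q → allBelow n p ≡ allBelow n q
allBelow-cong zero    p≗q = refl
allBelow-cong (suc n) p≗q = cong₂ _∧_ (allBelow-cong n p≗q) (p≗q n)

isCP-∷ : ∀ {n} x y (a b : Vec ℕ n) →
         isCP (x ∷ a , y ∷ b) ≡ columnOK x y (get a 0) (get a 1) (get b 0) ∧ isCP (a , b)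
isCP-∷ {n} x y a b = allBelow-suc n (columnOKAt (get (x ∷ a)) (get (y ∷ b)))

get-init : ∀ {n} (a : Vec ℕ (suc n)) → last a ≡ 0 → get (init a) ≗ get a
get-init {zero}  (x ∷ []) refl zero    = refl
get-init {zero}  (x ∷ []) refl (suc j) = refl
get-init {suc n} (x ∷ a)  aₙ≡0 zero    = refl
get-init {suc n} (x ∷ a)  aₙ≡0 (suc j) = get-init a aₙ≡0 j

columnOKAt-last : ∀ {n} (a b : Vec ℕ (suc n)) → last a ≡ 0 → last b ≡ 0 →
                  columnOKAt (get a) (get b) n ≡ true
columnOKAt-last {zero}  (x ∷ []) (y ∷ []) refl refl = refl
columnOKAt-last {suc n} (x ∷ a)  (y ∷ b)  = columnOKAt-last a b

isCP-init : ∀ {n} (a b : Vec ℕ (suc n)) → last a ≡ 0 → last b ≡ 0 →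
            isCP (init a , init b) ≡ isCP (a , b)
isCP-init {n} a b aₙ≡0 bₙ≡0 = begin
  allBelow n (columnOKAt (get (init a)) (get (init b)))
    ≡⟨ allBelow-cong n (columnOKAt-cong (get-init a aₙ≡0) (get-init b bₙ≡0)) ⟩
  allBelow n (columnOKAt (get a) (get b))
    ≡⟨ sym (∧-identityʳ _) ⟩
  allBelow n (columnOKAt (get a) (get b)) ∧ true
    ≡⟨ cong (allBelow n (columnOKAt (get a) (get b)) ∧_) (sym (columnOKAt-last a b aₙ≡0 bₙ≡0)) ⟩
  isCP (a , b) ∎

𝟙 : Bool → ℤ
𝟙 b = if b then 1ℤ else 0ℤ

indicator : ∀ {n} → (Exp n → Bool) → Series n
indicator P e = 𝟙 (P e)

CPsWith : ∀ {n} → (Exp n → Bool) → Exp n → Bool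
CPsWith K e = K e ∧ isCP e

record IsTranslate {n} (m : Exp n) (P Q : Exp n → Bool) : Set where
  field
    image   : ∀ e → Q (addE m e) ≡ P e
    support : ∀ e → T (Q e) → T (leqE m e)


shift-indicator : ∀ {n} {m : Exp n} {P Q} → IsTranslate m P Q →
                  shift m (indicator P) ≈ₛ indicator Q
shift-indicator {m = m} {P} {Q} t e with leqE m e in m≤e
... | true = cong 𝟙 (begin
  P (subE e m)           ≡⟨ sym (IsTranslate.image t (subE e m)) ⟩
  Q (addE m (subE e m))  ≡⟨ cong Q (addE-subE m e (subst T (sym m≤e) tt)) ⟩
  Q e                    ∎)
... | false with Q e in qe
...   | false = refl
...   | true  = ⊥-elim (subst T m≤e (IsTranslate.support t e (subst T (sym qe) tt)))

oneMinus-indicator : ∀ {n} {m : Exp n} {P Q} → IsTranslate m P Q →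
                     oneMinus m (indicator P) ≈ₛ λ e → indicator P e - indicator Q e
oneMinus-indicator {P = P} t e = cong (indicator P e -_) (shift-indicator t e)

oneMinus-cong : ∀ {n} (m : Exp n) {F G : Series n} → F ≈ₛ G → oneMinus m F ≈ₛ oneMinus m G
oneMinus-cong m F≈G e =
  cong₂ _-_ (F≈G e) (cong (λ z → if leqE m e then z else 0ℤ) (F≈G (subE e m)))

-- The new first column and the entries it is compared with all grow by c,
-- so the inequalities of the first column are unaffected.
IsTranslate-∷ : ∀ {n} c (ma : Vec ℕ n) (mb : Vec ℕ (suc n)) (K Ch : ∀ {k} → Exp (2 + k) → Bool) →
                (∀ x y a b → K {suc n} (x ∷ a , y ∷ b) ≡ K (a , b)) →
                (∀ x y a b → Ch {suc n} (x ∷ a , y ∷ b) ≡ Ch (a , b)) →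
                IsTranslate (c ∷ c ∷ ma , c ∷ mb) (CPsWith K) (CPsWith Ch) →
                IsTranslate (c ∷ c ∷ c ∷ ma , c ∷ c ∷ mb) (CPsWith K) (CPsWith Ch)
IsTranslate-∷ {n} c ma mb K Ch K-tail Ch-tail t = record { image = image′ ; support = support′ }
  where
  m : Exp (2 + n)
  m = (c ∷ c ∷ ma , c ∷ mb)

  m′ : Exp (3 + n)
  m′ = (c ∷ c ∷ c ∷ ma , c ∷ c ∷ mb)

  image′ : ∀ e → CPsWith Ch (addE m′ e) ≡ CPsWith K e
  image′ e@(x ∷ a@(a₀ ∷ a₁ ∷ _) , y ∷ b@(b₀ ∷ _)) = begin
    Ch (addE m′ e) ∧ isCP (addE m′ e)
      ≡⟨ cong₂ _∧_ (Ch-tail (c + x) (c + y) _ _) (isCP-∷ (c + x) (c + y) (proj₁ m+e′) (proj₂ m+e′)) ⟩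
    Ch m+e′ ∧ (columnOK (c + x) (c + y) (c + a₀) (c + a₁) (c + b₀) ∧ isCP m+e′)
      ≡⟨ cong (λ h → Ch m+e′ ∧ (h ∧ isCP m+e′)) (columnOK-+ c x y a₀ a₁ b₀) ⟩
    Ch m+e′ ∧ (columnOK x y a₀ a₁ b₀ ∧ isCP m+e′)
      ≡⟨ ∧-leftComm (Ch m+e′) (columnOK x y a₀ a₁ b₀) (isCP m+e′) ⟩
    columnOK x y a₀ a₁ b₀ ∧ CPsWith Ch m+e′
      ≡⟨ cong (columnOK x y a₀ a₁ b₀ ∧_) (IsTranslate.image t (a , b)) ⟩
    columnOK x y a₀ a₁ b₀ ∧ (K (a , b) ∧ isCP (a , b))
      ≡⟨ ∧-leftComm (columnOK x y a₀ a₁ b₀) (K (a , b)) (isCP (a , b)) ⟩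
    K (a , b) ∧ (columnOK x y a₀ a₁ b₀ ∧ isCP (a , b))
      ≡⟨ sym (cong₂ _∧_ (K-tail x y a b) (isCP-∷ x y a b)) ⟩
    K e ∧ isCP e ∎
    where m+e′ = addE m (a , b)

  support′ : ∀ e → T (CPsWith Ch e) → T (leqE m′ e)
  support′ e@(x ∷ a@(a₀ ∷ a₁ ∷ _) , y ∷ b@(b₀ ∷ _)) h
    with T-∧⁻ (Ch e) h
  ... | ch , cp with T-∧⁻ (columnOK x y a₀ a₁ b₀) (subst T (isCP-∷ x y a b) cp)
  ... | ok , cp′ with columnOK⁻ x y a₀ a₁ b₀ ok
  ... | a₀≤x , b₀≤y , _
    with T-∧⁻ (leqV (proj₁ m) a) (IsTranslate.support t (a , b) (T-∧⁺ (subst T (Ch-tail x y a b) ch) cp′))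
  ... | ma≤a , mb≤b = T-∧⁺ (T-∧⁺ (lift a₀≤x (proj₁ (T-∧⁻ (c ≤ᵇ a₀) ma≤a))) ma≤a)
                           (T-∧⁺ (lift b₀≤y (proj₁ (T-∧⁻ (c ≤ᵇ b₀) mb≤b))) mb≤b)
    where
    lift : ∀ {u v} → u ≤ v → T (c ≤ᵇ u) → T (c ≤ᵇ v)
    lift {u} u≤v c≤u = ≤⇒≤ᵇ (≤-trans (≤ᵇ⇒≤ c u c≤u) u≤v)

infixr 6 _∧̇_
infixr 5 _∨̇_

_∧̇_ _∨̇_ : ∀ {A : Set} → (A → Bool) → (A → Bool) → A → Bool
(P ∧̇ Q) x = P x ∧ Q x
(P ∨̇ Q) x = P x ∨ Q x

aₙ bₙ : ∀ {n} → Exp (suc n) → ℕ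
aₙ (a , b) = last a
bₙ (a , b) = last b

aₙ₋₁ bₙ₋₁ : ∀ {n} → Exp (2 + n) → ℕ
aₙ₋₁ (a , b) = last (init a)
bₙ₋₁ (a , b) = last (init b)

bₙ₋₂ : ∀ {n} → Exp (3 + n) → ℕ
bₙ₋₂ (a , b) = last (init (init b))

aₙ≡0 aₙ≡1 bₙ≡0 lastColumnZero : ∀ {n} → Exp (suc n) → Bool
aₙ≡0 e = aₙ e ≡ᵇ 0
aₙ≡1 e = aₙ e ≡ᵇ 1
bₙ≡0 e = bₙ e ≡ᵇ 0
lastColumnZero = aₙ≡0 ∧̇ bₙ≡0

bₙ₋₁≡0 : ∀ {n} → Exp (2 + n) → Bool
bₙ₋₁≡0 e = bₙ₋₁ e ≡ᵇ 0

-- For n = 2 there is no bₙ₋₂ to compare with.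
bₙ₋₁-strictlyBelow : ∀ {n} → Exp (2 + n) → Bool
bₙ₋₁-strictlyBelow {zero}  e = bₙ₋₁ e <ᵇ aₙ₋₁ e
bₙ₋₁-strictlyBelow {suc n} e = (bₙ₋₁ e <ᵇ aₙ₋₁ e) ∧ (bₙ₋₁ e <ᵇ bₙ₋₂ e)

-- Together with bₙ = 0, the condition for e to be Xₙ₋₁XₙYₙ₋₂Yₙ₋₁ times a partition
-- with vanishing last column.
raised : ∀ {n} → Exp (2 + n) → Bool
raised = aₙ≡1 ∧̇ not ∘ bₙ₋₁≡0 ∧̇ bₙ₋₁-strictlyBelow

reduced XₙYₙ₋₂·reduced : ∀ {n} → Exp (2 + n) → Bool
reduced        = bₙ≡0 ∧̇ (aₙ≡0 ∨̇ bₙ₋₁≡0)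
XₙYₙ₋₂·reduced = bₙ≡0 ∧̇ (bₙ₋₁≡0 ∧̇ not ∘ aₙ≡0 ∨̇ raised)

XₙYₙ XₙYₙ₋₁ XₙYₙ₋₂ Xₙ₋₁XₙYₙ₋₂Yₙ₋₁ : (n : ℕ) → Exp n
XₙYₙ   n = XY n n n
XₙYₙ₋₁ n = XY n n (n ∸ 1)
XₙYₙ₋₂ n = XY n n (n ∸ 2)
Xₙ₋₁XₙYₙ₋₂Yₙ₋₁ n = addE (XY n (n ∸ 1) (n ∸ 2)) (XY n n (n ∸ 1))

pattern E₂ a₀ a₁ b₀ b₁ = (a₀ ∷ a₁ ∷ [] , b₀ ∷ b₁ ∷ [])
pattern E₃ a₀ a₁ a₂ b₀ b₁ b₂ = (a₀ ∷ a₁ ∷ a₂ ∷ [] , b₀ ∷ b₁ ∷ b₂ ∷ [])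

CP₂ : ℕ → ℕ → ℕ → ℕ → Set
CP₂ a₀ a₁ b₀ b₁ = a₁ ≤ a₀ × b₁ ≤ b₀ × b₀ ≤ a₀ × b₁ ≤ a₁

CP₃ : ℕ → ℕ → ℕ → ℕ → ℕ → ℕ → Set
CP₃ a₀ a₁ a₂ b₀ b₁ b₂ =
  a₁ ≤ a₀ × b₁ ≤ b₀ × b₀ ≤ a₀ × a₂ ≤ b₀ × a₂ ≤ a₁ × b₂ ≤ b₁ × b₁ ≤ a₁ × b₂ ≤ a₂

isCP₂⁻ : ∀ a₀ a₁ b₀ b₁ → T (isCP (E₂ a₀ a₁ b₀ b₁)) → CP₂ a₀ a₁ b₀ b₁
isCP₂⁻ a₀ a₁ b₀ b₁ h with T-∧⁻ (columnOK a₀ b₀ a₁ 0 b₁) h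
... | h₀ , h₁ with columnOK⁻ a₀ b₀ a₁ 0 b₁ h₀ | columnOK⁻ a₁ b₁ 0 0 0 h₁
... | p , q , r , _ | _ , _ , s , _ = p , q , r , s

isCP₂⁺ : ∀ a₀ a₁ b₀ b₁ → CP₂ a₀ a₁ b₀ b₁ → T (isCP (E₂ a₀ a₁ b₀ b₁))
isCP₂⁺ _ _ _ _ (p , q , r , s) = T-∧⁺ (columnOK⁺ p q r z≤n) (columnOK⁺ z≤n z≤n s z≤n)

isCP₃⁻ : ∀ a₀ a₁ a₂ b₀ b₁ b₂ → T (isCP (E₃ a₀ a₁ a₂ b₀ b₁ b₂)) → CP₃ a₀ a₁ a₂ b₀ b₁ b₂
isCP₃⁻ a₀ a₁ a₂ b₀ b₁ b₂ h with T-∧⁻ (columnOK a₀ b₀ a₁ a₂ b₁ ∧ columnOK a₁ b₁ a₂ 0 b₂) h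
... | h₀₁ , h₂ with T-∧⁻ (columnOK a₀ b₀ a₁ a₂ b₁) h₀₁
... | h₀ , h₁
  with columnOK⁻ a₀ b₀ a₁ a₂ b₁ h₀ | columnOK⁻ a₁ b₁ a₂ 0 b₂ h₁ | columnOK⁻ a₂ b₂ 0 0 0 h₂
... | p , q , r , s | t , u , v , _ | _ , _ , w , _ = p , q , r , s , t , u , v , w

isCP₃⁺ : ∀ a₀ a₁ a₂ b₀ b₁ b₂ → CP₃ a₀ a₁ a₂ b₀ b₁ b₂ → T (isCP (E₃ a₀ a₁ a₂ b₀ b₁ b₂))
isCP₃⁺ _ _ _ _ _ _ (p , q , r , s , t , u , v , w) =
  T-∧⁺ (T-∧⁺ (columnOK⁺ p q r s) (columnOK⁺ t u v z≤n)) (columnOK⁺ z≤n z≤n w z≤n)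

CPsWith⇒isCP : ∀ {n} (K : Exp n → Bool) e → T (CPsWith K e) → T (isCP e)
CPsWith⇒isCP K e h = proj₂ (T-∧⁻ (K e) h)

translate₂-XₙYₙ : IsTranslate (XₙYₙ 2) isCP (CPsWith (not ∘ bₙ≡0))
translate₂-XₙYₙ = record { image = image ; support = support }
  where
  image : ∀ e → CPsWith (not ∘ bₙ≡0) (addE (XₙYₙ 2) e) ≡ isCP e
  image (E₂ a₀ a₁ b₀ b₁)
    rewrite <ᵇ-suc a₁ a₀ | <ᵇ-suc b₁ b₀ | <ᵇ-suc b₀ a₀ | <ᵇ-suc b₁ a₁ = refl
  support : ∀ e → T (CPsWith (not ∘ bₙ≡0) e) → T (leqE (XₙYₙ 2) e)
  support (E₂ a₀ a₁ b₀ zero)     ()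
  support (E₂ a₀ a₁ b₀ (suc b₁)) h with isCP₂⁻ a₀ a₁ b₀ (suc b₁) h
  ... | s≤s _ , s≤s _ , _ , s≤s _ = tt

translate₂-XₙYₙ₋₁ : IsTranslate (XₙYₙ₋₁ 2) (CPsWith bₙ≡0) (CPsWith (bₙ≡0 ∧̇ not ∘ (aₙ≡0 ∨̇ bₙ₋₁≡0)))
translate₂-XₙYₙ₋₁ = record { image = image ; support = support }
  where
  image : ∀ e → CPsWith (bₙ≡0 ∧̇ not ∘ (aₙ≡0 ∨̇ bₙ₋₁≡0)) (addE (XₙYₙ₋₁ 2) e) ≡ CPsWith bₙ≡0 e
  image (E₂ a₀ a₁ b₀ (suc b₁)) = refl
  image (E₂ a₀ a₁ b₀ zero)     rewrite <ᵇ-suc a₁ a₀ | <ᵇ-suc b₀ a₀ = refl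
  support : ∀ e → T (CPsWith (bₙ≡0 ∧̇ not ∘ (aₙ≡0 ∨̇ bₙ₋₁≡0)) e) → T (leqE (XₙYₙ₋₁ 2) e)
  support (E₂ a₀ a₁       b₀       (suc b₁)) ()
  support (E₂ a₀ zero     b₀       zero)     ()
  support (E₂ a₀ (suc a₁) zero     zero)     ()
  support (E₂ a₀ (suc a₁) (suc b₀) zero)     h with isCP₂⁻ a₀ (suc a₁) (suc b₀) 0 h
  ... | s≤s _ , _ = tt

translate₂-XₙYₙ₋₂ : IsTranslate (XₙYₙ₋₂ 2) (CPsWith reduced) (CPsWith XₙYₙ₋₂·reduced)
translate₂-XₙYₙ₋₂ = record { image = image ; support = support }
  where
  image : ∀ e → CPsWith XₙYₙ₋₂·reduced (addE (XₙYₙ₋₂ 2) e) ≡ CPsWith reduced e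
  image (E₂ a₀ a₁       b₀       (suc b₁)) = refl
  image (E₂ a₀ zero     zero     zero)     = refl
  image (E₂ a₀ zero     (suc b₀) zero)     = T-injective
    (λ h → isCP₂⁺ a₀ 0 (suc b₀) 0 (z≤n , z≤n , <ᵇ⇒< b₀ a₀ (proj₁ (T-∧⁻ (b₀ <ᵇ a₀) h)) , z≤n))
    (λ h → let _ , _ , b₀<a₀ , _ = isCP₂⁻ a₀ 0 (suc b₀) 0 h
           in T-∧⁺ (<⇒<ᵇ b₀<a₀) (isCP₂⁺ (suc a₀) 1 (suc b₀) 0 (s≤s z≤n , z≤n , m≤n⇒m≤1+n b₀<a₀ , z≤n)))
  image (E₂ a₀ (suc a₁) zero     zero)     = refl
  image (E₂ a₀ (suc a₁) (suc b₀) zero)     = refl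
  support : ∀ e → T (CPsWith XₙYₙ₋₂·reduced e) → T (leqE (XₙYₙ₋₂ 2) e)
  support (E₂ a₀ a₁       b₀       (suc b₁)) ()
  support (E₂ a₀ zero     zero     zero)     ()
  support (E₂ a₀ zero     (suc b₀) zero)     ()
  support e@(E₂ a₀ (suc a₁) b₀     zero)     h
    with isCP₂⁻ a₀ (suc a₁) b₀ 0 (CPsWith⇒isCP XₙYₙ₋₂·reduced e h)
  ... | s≤s _ , _ = tt

translate₃-XₙYₙ₋₂ : IsTranslate (XₙYₙ₋₂ 3) (CPsWith reduced) (CPsWith XₙYₙ₋₂·reduced)
translate₃-XₙYₙ₋₂ = record { image = image ; support = support }
  where
  image : ∀ e → CPsWith XₙYₙ₋₂·reduced (addE (XₙYₙ₋₂ 3) e) ≡ CPsWith reduced e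
  image (E₃ a₀ a₁ a₂       b₀ b₁       (suc b₂)) = refl
  image (E₃ a₀ a₁ zero     b₀ zero     zero)     rewrite <ᵇ-suc a₁ a₀ | <ᵇ-suc b₀ a₀ = refl
  image (E₃ a₀ a₁ zero     b₀ (suc b₁) zero)     = T-injective
    (λ h → let strict , cp = T-∧⁻ ((b₁ <ᵇ a₁) ∧ (b₁ <ᵇ b₀)) h
               b₁<a₁ , b₁<b₀ = T-∧⁻ (b₁ <ᵇ a₁) strict
               a₁≤a₀ , _ , b₀≤a₀ , _ = isCP₃⁻ (suc a₀) (suc a₁) 1 (suc b₀) (suc b₁) 0 cp
           in isCP₃⁺ a₀ a₁ 0 b₀ (suc b₁) 0 (s≤s⁻¹ a₁≤a₀ , <ᵇ⇒< _ _ b₁<b₀ , s≤s⁻¹ b₀≤a₀ ,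
                                             z≤n , z≤n , z≤n , <ᵇ⇒< _ _ b₁<a₁ , z≤n))
    (λ h → let a₁≤a₀ , b₁<b₀ , b₀≤a₀ , _ , _ , _ , b₁<a₁ , _ = isCP₃⁻ a₀ a₁ 0 b₀ (suc b₁) 0 h
           in T-∧⁺ (T-∧⁺ (<⇒<ᵇ b₁<a₁) (<⇒<ᵇ b₁<b₀))
                   (isCP₃⁺ (suc a₀) (suc a₁) 1 (suc b₀) (suc b₁) 0
                           (s≤s a₁≤a₀ , m≤n⇒m≤1+n b₁<b₀ , s≤s b₀≤a₀ , s≤s z≤n ,
                            s≤s z≤n , z≤n , m≤n⇒m≤1+n b₁<a₁ , z≤n)))
  image (E₃ a₀ a₁ (suc a₂) b₀ zero     zero)     rewrite <ᵇ-suc a₁ a₀ | <ᵇ-suc b₀ a₀ = refl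
  image (E₃ a₀ a₁ (suc a₂) b₀ (suc b₁) zero)     = refl
  support : ∀ e → T (CPsWith XₙYₙ₋₂·reduced e) → T (leqE (XₙYₙ₋₂ 3) e)
  support (E₃ a₀ a₁ a₂     b₀ b₁       (suc b₂)) ()
  support (E₃ a₀ a₁ zero   b₀ zero     zero)     ()
  support (E₃ a₀ a₁ zero   b₀ (suc b₁) zero)     ()
  support e@(E₃ a₀ a₁ (suc a₂) b₀ b₁   zero)     h
    with isCP₃⁻ a₀ a₁ (suc a₂) b₀ b₁ 0 (CPsWith⇒isCP XₙYₙ₋₂·reduced e h)
  ... | s≤s _ , _ , _ , s≤s _ , s≤s _ , _ = tt

translate₂-Xₙ₋₁XₙYₙ₋₂Yₙ₋₁ :
  IsTranslate (Xₙ₋₁XₙYₙ₋₂Yₙ₋₁ 2) (CPsWith lastColumnZero) (CPsWith (bₙ≡0 ∧̇ raised))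
translate₂-Xₙ₋₁XₙYₙ₋₂Yₙ₋₁ = record { image = image ; support = support }
  where
  image : ∀ e → CPsWith (bₙ≡0 ∧̇ raised) (addE (Xₙ₋₁XₙYₙ₋₂Yₙ₋₁ 2) e) ≡ CPsWith lastColumnZero e
  image (E₂ a₀ (suc a₁) b₀ zero)     = refl
  image (E₂ a₀ (suc a₁) b₀ (suc b₁)) = refl
  image (E₂ a₀ zero     b₀ (suc b₁)) = refl
  image (E₂ a₀ zero     b₀ zero)     = T-injective
    (λ h → let b₀≤a₀ = ≤ᵇ⇒≤ b₀ a₀ (subst T (<ᵇ-suc b₀ a₀) (proj₁ (T-∧⁻ (b₀ <ᵇ suc a₀) h)))
           in isCP₂⁺ a₀ 0 b₀ 0 (z≤n , z≤n , b₀≤a₀ , z≤n))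
    (λ h → let _ , _ , b₀≤a₀ , _ = isCP₂⁻ a₀ 0 b₀ 0 h
           in T-∧⁺ (<⇒<ᵇ (s≤s b₀≤a₀))
                   (isCP₂⁺ (2 + a₀) 1 (suc b₀) 0 (s≤s z≤n , z≤n , s≤s (m≤n⇒m≤1+n b₀≤a₀) , z≤n)))
  support : ∀ e → T (CPsWith (bₙ≡0 ∧̇ raised) e) → T (leqE (Xₙ₋₁XₙYₙ₋₂Yₙ₋₁ 2) e)
  support (E₂ a₀             a₁             b₀       (suc b₁)) ()
  support (E₂ a₀             zero           b₀       zero)     ()
  support (E₂ a₀             (suc (suc a₁)) b₀       zero)     ()
  support (E₂ a₀             (suc zero)     zero     zero)     ()
  support (E₂ zero           (suc zero)     (suc b₀) zero)     ()
  support (E₂ (suc zero)     (suc zero)     (suc b₀) zero)     ()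
  support (E₂ (suc (suc a₀)) (suc zero)     (suc b₀) zero)     _ = tt

translate₃-Xₙ₋₁XₙYₙ₋₂Yₙ₋₁ :
  IsTranslate (Xₙ₋₁XₙYₙ₋₂Yₙ₋₁ 3) (CPsWith lastColumnZero) (CPsWith (bₙ≡0 ∧̇ raised))
translate₃-Xₙ₋₁XₙYₙ₋₂Yₙ₋₁ = record { image = image ; support = support }
  where
  image : ∀ e → CPsWith (bₙ≡0 ∧̇ raised) (addE (Xₙ₋₁XₙYₙ₋₂Yₙ₋₁ 3) e) ≡ CPsWith lastColumnZero e
  image (E₃ a₀ a₁ (suc a₂) b₀ b₁ zero)     = refl
  image (E₃ a₀ a₁ (suc a₂) b₀ b₁ (suc b₂)) = refl
  image (E₃ a₀ a₁ zero     b₀ b₁ (suc b₂)) = refl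
  image (E₃ a₀ a₁ zero     b₀ b₁ zero)     = T-injective
    (λ h → let strict , cp = T-∧⁻ ((b₁ <ᵇ suc a₁) ∧ (b₁ <ᵇ suc b₀)) h
               b₁<1+a₁ , b₁<1+b₀ = T-∧⁻ (b₁ <ᵇ suc a₁) strict
               a₁≤a₀ , _ , b₀≤a₀ , _ = isCP₃⁻ (2 + a₀) (2 + a₁) 1 (2 + b₀) (1 + b₁) 0 cp
           in isCP₃⁺ a₀ a₁ 0 b₀ b₁ 0 (s≤s⁻¹ (s≤s⁻¹ a₁≤a₀) , s≤s⁻¹ (<ᵇ⇒< _ _ b₁<1+b₀) ,
                                       s≤s⁻¹ (s≤s⁻¹ b₀≤a₀) , z≤n , z≤n , z≤n ,
                                       s≤s⁻¹ (<ᵇ⇒< _ _ b₁<1+a₁) , z≤n))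
    (λ h → let a₁≤a₀ , b₁≤b₀ , b₀≤a₀ , _ , _ , _ , b₁≤a₁ , _ = isCP₃⁻ a₀ a₁ 0 b₀ b₁ 0 h
           in T-∧⁺ (T-∧⁺ (<⇒<ᵇ (s≤s b₁≤a₁)) (<⇒<ᵇ (s≤s b₁≤b₀)))
                   (isCP₃⁺ (2 + a₀) (2 + a₁) 1 (2 + b₀) (1 + b₁) 0
                           (s≤s (s≤s a₁≤a₀) , s≤s (m≤n⇒m≤1+n b₁≤b₀) , s≤s (s≤s b₀≤a₀) ,
                            s≤s z≤n , s≤s z≤n , z≤n , s≤s (m≤n⇒m≤1+n b₁≤a₁) , z≤n)))
  support : ∀ e → T (CPsWith (bₙ≡0 ∧̇ raised) e) → T (leqE (Xₙ₋₁XₙYₙ₋₂Yₙ₋₁ 3) e)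
  support (E₃ a₀ a₁ a₂             b₀ b₁       (suc b₂)) ()
  support (E₃ a₀ a₁ zero           b₀ b₁       zero)     ()
  support (E₃ a₀ a₁ (suc (suc a₂)) b₀ b₁       zero)     ()
  support (E₃ a₀ a₁ (suc zero)     b₀ zero     zero)     ()
  support (E₃ a₀ a₁ (suc zero)     b₀ (suc b₁) zero)     h
    with T-∧⁻ ((suc b₁ <ᵇ a₁) ∧ (suc b₁ <ᵇ b₀)) h
  ... | strict , cp with T-∧⁻ (suc b₁ <ᵇ a₁) strict
  ... | b₁<a₁ , b₁<b₀
    with <ᵇ⇒< (suc b₁) a₁ b₁<a₁ | <ᵇ⇒< (suc b₁) b₀ b₁<b₀ | isCP₃⁻ a₀ a₁ 1 b₀ (suc b₁) 0 cp
  ... | s≤s (s≤s _) | s≤s (s≤s _) | s≤s (s≤s _) , _ = tt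

translate-XₙYₙ : ∀ k → IsTranslate (XₙYₙ (2 + k)) isCP (CPsWith (not ∘ bₙ≡0))
translate-XₙYₙ zero    = translate₂-XₙYₙ
translate-XₙYₙ (suc k) =
  IsTranslate-∷ 1 _ _ (λ _ → true) (not ∘ bₙ≡0) (λ _ _ _ _ → refl) (λ _ _ _ _ → refl)
                (translate-XₙYₙ k)

translate-XₙYₙ₋₁ : ∀ k → IsTranslate (XₙYₙ₋₁ (2 + k)) (CPsWith bₙ≡0)
                                     (CPsWith (bₙ≡0 ∧̇ not ∘ (aₙ≡0 ∨̇ bₙ₋₁≡0)))
translate-XₙYₙ₋₁ zero    = translate₂-XₙYₙ₋₁
translate-XₙYₙ₋₁ (suc k) =
  IsTranslate-∷ 1 _ _ bₙ≡0 (bₙ≡0 ∧̇ not ∘ (aₙ≡0 ∨̇ bₙ₋₁≡0)) (λ _ _ _ _ → refl) (λ _ _ _ _ → refl)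
                (translate-XₙYₙ₋₁ k)

translate-XₙYₙ₋₂ : ∀ k → IsTranslate (XₙYₙ₋₂ (2 + k)) (CPsWith reduced) (CPsWith XₙYₙ₋₂·reduced)
translate-XₙYₙ₋₂ zero          = translate₂-XₙYₙ₋₂
translate-XₙYₙ₋₂ (suc zero)    = translate₃-XₙYₙ₋₂
translate-XₙYₙ₋₂ (suc (suc k)) =
  IsTranslate-∷ 1 _ _ reduced XₙYₙ₋₂·reduced (λ _ _ _ _ → refl) (λ _ _ _ _ → refl)
                (translate-XₙYₙ₋₂ (suc k))

translate-Xₙ₋₁XₙYₙ₋₂Yₙ₋₁ : ∀ k → IsTranslate (Xₙ₋₁XₙYₙ₋₂Yₙ₋₁ (2 + k)) (CPsWith lastColumnZero)
                                             (CPsWith (bₙ≡0 ∧̇ raised))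
translate-Xₙ₋₁XₙYₙ₋₂Yₙ₋₁ zero          = translate₂-Xₙ₋₁XₙYₙ₋₂Yₙ₋₁
translate-Xₙ₋₁XₙYₙ₋₂Yₙ₋₁ (suc zero)    = translate₃-Xₙ₋₁XₙYₙ₋₂Yₙ₋₁
translate-Xₙ₋₁XₙYₙ₋₂Yₙ₋₁ (suc (suc k)) =
  IsTranslate-∷ 2 _ _ lastColumnZero (bₙ≡0 ∧̇ raised) (λ _ _ _ _ → refl) (λ _ _ _ _ → refl)
                (translate-Xₙ₋₁XₙYₙ₋₂Yₙ₋₁ (suc k))

extend-CP : ∀ k → extend (CP k) ≈ₛ indicator (CPsWith lastColumnZero)
extend-CP k (a , b) with last a ≡ᵇ 0 in aₙ≡0 | last b ≡ᵇ 0 in bₙ≡0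
... | false | _     = refl
... | true  | false = refl
... | true  | true  =
  cong 𝟙 (isCP-init a b (≡ᵇ⇒≡ _ 0 (subst T (sym aₙ≡0) tt)) (≡ᵇ⇒≡ _ 0 (subst T (sym bₙ≡0) tt)))

𝟙-complement : ∀ k q p → 𝟙 (k ∧ p) - 𝟙 ((k ∧ not q) ∧ p) ≡ 𝟙 ((k ∧ q) ∧ p)
𝟙-complement false q     p     = refl
𝟙-complement true  false false = refl
𝟙-complement true  false true  = refl
𝟙-complement true  true  false = refl
𝟙-complement true  true  true  = refl

𝟙-exchange : ∀ β α B r g p →
  𝟙 ((β ∧ (α ∨ B)) ∧ p) - 𝟙 ((β ∧ (B ∧ not α ∨ r ∧ not B ∧ g)) ∧ p)
    ≡ 𝟙 ((α ∧ β) ∧ p) - 𝟙 ((β ∧ r ∧ not B ∧ g) ∧ p)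
𝟙-exchange false false _     _     _ _     = refl
𝟙-exchange false true  _     _     _ _     = refl
𝟙-exchange true  true  true  false _ _     = refl
𝟙-exchange true  true  true  true  _ _     = refl
𝟙-exchange true  true  false _     _ _     = refl
𝟙-exchange true  false true  false _ false = refl
𝟙-exchange true  false true  false _ true  = refl
𝟙-exchange true  false true  true  _ false = refl
𝟙-exchange true  false true  true  _ true  = refl
𝟙-exchange true  false false _     _ _     = refl

theorem3p3 : (n : ℕ) → 1 < n →
    oneMinus (XY n n (n ∸ 2)) (oneMinus (XY n n (n ∸ 1)) (oneMinus (XY n n n) (CP n)))
      ≈ₛ oneMinus (addE (XY n (n ∸ 1) (n ∸ 2)) (XY n n (n ∸ 1))) (CPprev n)
theorem3p3 (suc zero)    (s≤s ())
theorem3p3 (suc (suc k)) _ e = begin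
  oneMinus (XₙYₙ₋₂ n) (oneMinus (XₙYₙ₋₁ n) (oneMinus (XₙYₙ n) (CP n))) e
    ≡⟨ oneMinus-cong (XₙYₙ₋₂ n) after-XₙYₙ₋₁ e ⟩
  oneMinus (XₙYₙ₋₂ n) (indicator (CPsWith reduced)) e
    ≡⟨ oneMinus-indicator (translate-XₙYₙ₋₂ k) e ⟩
  indicator (CPsWith reduced) e - indicator (CPsWith XₙYₙ₋₂·reduced) e
    ≡⟨ 𝟙-exchange (bₙ≡0 e) (aₙ≡0 e) (bₙ₋₁≡0 e) (aₙ≡1 e) (bₙ₋₁-strictlyBelow e) (isCP e) ⟩
  indicator (CPsWith lastColumnZero) e - indicator (CPsWith (bₙ≡0 ∧̇ raised)) e
    ≡⟨ sym (oneMinus-indicator (translate-Xₙ₋₁XₙYₙ₋₂Yₙ₋₁ k) e) ⟩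
  oneMinus (Xₙ₋₁XₙYₙ₋₂Yₙ₋₁ n) (indicator (CPsWith lastColumnZero)) e
    ≡⟨ sym (oneMinus-cong (Xₙ₋₁XₙYₙ₋₂Yₙ₋₁ n) (extend-CP (suc k)) e) ⟩
  oneMinus (Xₙ₋₁XₙYₙ₋₂Yₙ₋₁ n) (CPprev n) e ∎
  where
  n = 2 + k
  after-XₙYₙ : oneMinus (XₙYₙ n) (CP n) ≈ₛ indicator (CPsWith bₙ≡0)
  after-XₙYₙ e =
    trans (oneMinus-indicator (translate-XₙYₙ k) e) (𝟙-complement true (bₙ≡0 e) (isCP e))
  after-XₙYₙ₋₁ : oneMinus (XₙYₙ₋₁ n) (oneMinus (XₙYₙ n) (CP n)) ≈ₛ indicator (CPsWith reduced)
  after-XₙYₙ₋₁ e = trans (oneMinus-cong (XₙYₙ₋₁ n) after-XₙYₙ e)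
    (trans (oneMinus-indicator (translate-XₙYₙ₋₁ k) e)
           (𝟙-complement (bₙ≡0 e) (aₙ≡0 e ∨ bₙ₋₁≡0 e) (isCP e)))
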